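{- Let $k,l\ge1$ with $k\ne l$, and $1\le r\le 4kl$. Let $\overline{\mathcal{B}}(2k,2l;r)$ be the set of boards in $\mathcal{B}(2k,2l;r)$ whose board partition $(\lambda_1,\lambda_2,\lambda_3,\lambda_4)$ satisfies: (i) $\lambda_1\ge\lambda_i$ for all $i>1$; (ii) if $\lambda_1=\lambda_2$ then $\lambda_3\ge\lambda_4$; (iii) if $\lambda_1=\lambda_3$ then $\lambda_2\ge\lambda_4$; (iv) if $\lambda_1=\lambda_4$ then $\lambda_2\ge\lambda_3$. Then: (1) $\overline{\mathcal{B}}(2k,2l;r)$ is the disjoint union of the sets of all boards of $\mathcal{B}(2k,2l;r)$ having a given board partition, over finitely many board partitions; (2) every board in $\mathcal{B}(2k,2l;r)$ is equivalent under $G=\{R_0,H,V,R_{180}\}$ to some board in $\overline{\mathcal{B}}(2k,2l;r)$; (3) any two boards in $\overline{\mathcal{B}}(2k,2l;r)$ equivalent under $G$ have the same board partition.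
   Context: A $2k\times 2l$ grid has cells $(i,j)$, $1\le i\le 2k$ (row from top), $1\le j\le 2l$ (column from left). $\mathcal{B}(2k,2l;r)$ is the set of all choices of exactly $r$ blocked cells. The group $G=\{R_0,H,V,R_{180}\}$ acts on boards: $R_0$ identity, $H$ reflection across the horizontal midline ($(i,j)\mapsto(2k+1-i,j)$), $V$ reflection across the vertical midline ($(i,j)\mapsto(i,2l+1-j)$), $R_{180}$ rotation by 180 degrees. Boards are equivalent if one is an image of the other. The board partition is $(\lambda_1,\lambda_2,\lambda_3,\lambda_4)$, the numbers of blocked cells in the upper-left (rows $1..k$, columns $1..l$), upper-right (rows $1..k$, columns $l+1..2l$), lower-right (rows $k+1..2k$, columns $l+1..2l$) and lower-left (rows $k+1..2k$, columns $1..l$) quadrants. -}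

module Defs where

open import Data.Nat using (ℕ; zero; suc; _+_; _*_; _<ᵇ_; _≤_)
open import Data.Nat.Properties using (_≟_)
open import Data.Fin using (Fin; toℕ; opposite)
open import Data.Bool using (Bool; true; false; if_then_else_; _∧_; not)
open import Data.Product using (_×_; _,_)
open import Relation.Binary.PropositionalEquality using (_≡_)

ΣFin : (n : ℕ) → (Fin n → ℕ) → ℕ
ΣFin zero f = 0
ΣFin (suc n) f = f Fin.zero + ΣFin n (λ i → f (Fin.suc i))

-- A board on a 2k × 2l grid: b i j = true iff cell (i,j) is blocked.
-- Rows/columns are 0-indexed here (Fin), i.e. cell (i+1, j+1) of the paper.
record Board (k l : ℕ) : Set where
  constructor board
  field cell : Fin (2 * k) → Fin (2 * l) → Bool
open Board public

countWhere : ∀ {k l} → (Fin (2 * k) → Fin (2 * l) → Bool) → Board k l → ℕ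
countWhere {k} {l} p b =
  ΣFin (2 * k) (λ i → ΣFin (2 * l) (λ j → if p i j ∧ cell b i j then 1 else 0))

blocked : ∀ {k l} → Board k l → ℕ
blocked = countWhere (λ _ _ → true)

InB : ∀ {k l} → ℕ → Board k l → Set
InB r b = blocked b ≡ r

top : ∀ {k} → Fin (2 * k) → Bool
top {k} i = toℕ i <ᵇ k

left : ∀ {l} → Fin (2 * l) → Bool
left {l} j = toℕ j <ᵇ l

Partition : Set
Partition = ℕ × ℕ × ℕ × ℕ

partition : ∀ {k l} → Board k l → Partition
partition {k} {l} b =
  countWhere (λ i j → top {k} i ∧ left {l} j) b ,
  countWhere (λ i j → top {k} i ∧ not (left {l} j)) b ,
  countWhere (λ i j → not (top {k} i) ∧ not (left {l} j)) b ,
  countWhere (λ i j → not (top {k} i) ∧ left {l} j) b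

Good : Partition → Set
Good (l₁ , l₂ , l₃ , l₄) =
  (l₂ ≤ l₁ × l₃ ≤ l₁ × l₄ ≤ l₁) ×
  (l₁ ≡ l₂ → l₄ ≤ l₃) ×
  (l₁ ≡ l₃ → l₄ ≤ l₂) ×
  (l₁ ≡ l₄ → l₃ ≤ l₂)

InBbar : ∀ {k l} → ℕ → Board k l → Set
InBbar r b = InB r b × Good (partition b)

data G : Set where
  R0 H V R180 : G

-- action on boards: (g · b)(i,j) = b(g⁻¹(i,j)); each element is an involution.
-- opposite i = 2k-1-i (0-indexed), i.e. i ↦ 2k+1-i in 1-indexed terms.
act : ∀ {k l} → G → Board k l → Board k l
act R0   b = board (λ i j → cell b i j)
act H    b = board (λ i j → cell b (opposite i) j)
act V    b = board (λ i j → cell b i (opposite j))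
act R180 b = board (λ i j → cell b (opposite i) (opposite j))

_≈[_]_ : ∀ {k l} → Board k l → G → Board k l → Set
b ≈[ g ] b' = ∀ i j → cell (act g b) i j ≡ cell b' i j

-- Reflecting rows maps the top half onto the bottom half (i < k iff 2k-1-i ≥ k), so each
-- element of G permutes the quadrant counts: H reverses them, V swaps λ₁↔λ₂ and λ₃↔λ₄,
-- R₁₈₀ swaps λ₁↔λ₃ and λ₂↔λ₄; the total count is invariant.  Conditions (i)–(iv) say that
-- the partition is not lexicographically smaller than any of its three permutations, so the
-- image of a board with lexicographically largest partition lies in the restricted set.  If λ
-- and gλ (g ≠ R₀) both satisfy (i)–(iv), then (i) makes the entry moved to the front equal to
-- λ₁ and the tie-break condition for that entry makes the other swapped pair equal, so gλ = λ.

module Submission where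

open import Defs
open import Data.Nat using (ℕ; zero; suc; _+_; _*_; _∸_; _≤_; _<_; s≤s; z≤n; _<?_; _≤?_)
open import Data.Nat.Properties
  using (_≟_; ≤-refl; ≤-antisym; +-mono-≤; +-monoʳ-≤; +-cancelʳ-≤; +-identityʳ; +-suc; module ≤-Reasoning
        ; <-irrefl; ≮⇒≥; m∸n+n≡m; ≤-decTotalOrder; +-0-commutativeMonoid)
open import Data.Fin using (Fin; toℕ; opposite)
open import Data.Fin.Properties using (opposite-prop; opposite-involutive; toℕ<n)
import Data.Fin.Permutation as Permutation
open import Data.Bool using (Bool; true; false; if_then_else_; _∧_; not; _xor_)
open import Data.Bool.Properties using (not-involutive)
open import Data.Product using (_×_; _,_; proj₂; ∃-syntax)
open import Data.Product.Relation.Binary.Lex.NonStrict using (×-Lex; ×-decTotalOrder)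
open import Data.Sum using (inj₁; inj₂)
open import Data.List using (List; []; _∷_; filter; cartesianProduct; upTo)
open import Data.List.Membership.Propositional using (_∈_)
open import Data.List.Membership.Propositional.Properties
  using (∈-filter⁺; ∈-filter⁻; ∈-cartesianProduct⁺; ∈-upTo⁺)
open import Data.List.Relation.Unary.All using (lookup)
open import Data.List.Relation.Unary.Any using (here; there)
open import Function using (_∘_; id)
open import Function.Bundles using (_⇔_; mk⇔)
open import Level using (0ℓ)
open import Relation.Binary using (Rel; DecTotalOrder; TotalOrder)
open import Relation.Binary.PropositionalEquality
  using (_≡_; _≢_; refl; sym; trans; cong; cong₂; subst; module ≡-Reasoning)
open import Relation.Nullary using (Dec; ¬_; contradiction; ¬?)
open import Relation.Nullary.Decidable using (does-⇔; _×-dec_; _→-dec_)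
import Algebra.Properties.CommutativeMonoid.Sum +-0-commutativeMonoid as ℕ-Sum
import Data.List.Extrema

ΣFin-cong : ∀ n {f g : Fin n → ℕ} → (∀ i → f i ≡ g i) → ΣFin n f ≡ ΣFin n g
ΣFin-cong zero    f≗g = refl
ΣFin-cong (suc n) f≗g = cong₂ _+_ (f≗g Fin.zero) (ΣFin-cong n (f≗g ∘ Fin.suc))

ΣFin-mono : ∀ n {f g : Fin n → ℕ} → (∀ i → f i ≤ g i) → ΣFin n f ≤ ΣFin n g
ΣFin-mono zero    f≤g = z≤n
ΣFin-mono (suc n) f≤g = +-mono-≤ (f≤g Fin.zero) (ΣFin-mono n (f≤g ∘ Fin.suc))

ΣFin≡sum : ∀ n (f : Fin n → ℕ) → ΣFin n f ≡ ℕ-Sum.sum f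
ΣFin≡sum zero    f = refl
ΣFin≡sum (suc n) f = cong (f Fin.zero +_) (ΣFin≡sum n (f ∘ Fin.suc))

ΣFin-reverse : ∀ n (f : Fin n → ℕ) → ΣFin n (f ∘ opposite) ≡ ΣFin n f
ΣFin-reverse n f = begin
  ΣFin n (f ∘ opposite)    ≡⟨ ΣFin≡sum n (f ∘ opposite) ⟩
  ℕ-Sum.sum (f ∘ opposite) ≡⟨ ℕ-Sum.∑-permute f Permutation.reverse ⟨
  ℕ-Sum.sum f              ≡⟨ ΣFin≡sum n f ⟨
  ΣFin n f                 ∎
  where open ≡-Reasoning

reflect : ∀ {n} → Bool → Fin n → Fin n
reflect false = id
reflect true  = opposite

reflect-involutive : ∀ {n} s (i : Fin n) → reflect s (reflect s i) ≡ i
reflect-involutive false i = refl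
reflect-involutive true  i = opposite-involutive i

ΣFin-reflect : ∀ n s (f : Fin n → ℕ) → ΣFin n (f ∘ reflect s) ≡ ΣFin n f
ΣFin-reflect n false f = refl
ΣFin-reflect n true  f = ΣFin-reverse n f

<-complement : ∀ {m n k} → m + suc n ≡ k + k → (m < k ⇔ (¬ n < k))
<-complement {m} {n} {k} m+n+1≡2k = mk⇔ not-both (λ n≮k → at-least-one (≮⇒≥ n≮k))
  where
  not-both : m < k → ¬ n < k
  not-both m<k n<k = <-irrefl m+n+1≡2k (+-mono-≤ m<k n<k)
  at-least-one : k ≤ n → m < k
  at-least-one k≤n = +-cancelʳ-≤ k (suc m) k (begin
    suc m + k ≡⟨ +-suc m k ⟨
    m + suc k ≤⟨ +-monoʳ-≤ m (s≤s k≤n) ⟩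
    m + suc n ≡⟨ m+n+1≡2k ⟩
    k + k     ∎)
    where open ≤-Reasoning

top-opposite : ∀ {k} (i : Fin (2 * k)) → top {k} (opposite i) ≡ not (top {k} i)
top-opposite {k} i =
  does-⇔ (<-complement opposite+i≡2k) (toℕ (opposite i) <? k) (¬? (toℕ i <? k))
  where
  open ≡-Reasoning
  opposite+i≡2k : toℕ (opposite i) + suc (toℕ i) ≡ k + k
  opposite+i≡2k = begin
    toℕ (opposite i) + suc (toℕ i)    ≡⟨ cong (_+ suc (toℕ i)) (opposite-prop i) ⟩
    2 * k ∸ suc (toℕ i) + suc (toℕ i) ≡⟨ m∸n+n≡m (toℕ<n i) ⟩
    2 * k                             ≡⟨ cong (k +_) (+-identityʳ k) ⟩
    k + k                             ∎

top-reflect : ∀ {k} s (i : Fin (2 * k)) → top {k} (reflect s i) ≡ s xor top {k} i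
top-reflect     false i = refl
top-reflect {k} true  i = top-opposite {k} i

onSide : Bool → Bool → Bool
onSide true  x = x
onSide false x = not x

onSide-xor : ∀ s t x → onSide t (s xor x) ≡ onSide (s xor t) x
onSide-xor false t     x = refl
onSide-xor true  true  x = refl
onSide-xor true  false x = not-involutive x

flipsRows flipsCols : G → Bool
flipsRows R0   = false
flipsRows H    = true
flipsRows V    = false
flipsRows R180 = true
flipsCols R0   = false
flipsCols H    = false
flipsCols V    = true
flipsCols R180 = true

fromQuadrants : (Bool → Bool → ℕ) → Partition
fromQuadrants f = f true true , f true false , f false false , f false true

fromQuadrants-cong : ∀ {f f′ : Bool → Bool → ℕ} → (∀ t u → f t u ≡ f′ t u) →
                     fromQuadrants f ≡ fromQuadrants f′
fromQuadrants-cong f≗f′ =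
  cong₂ _,_ (f≗f′ _ _) (cong₂ _,_ (f≗f′ _ _) (cong₂ _,_ (f≗f′ _ _) (f≗f′ _ _)))

permute : G → Partition → Partition
permute R0   p                   = p
permute H    (l₁ , l₂ , l₃ , l₄) = l₄ , l₃ , l₂ , l₁
permute V    (l₁ , l₂ , l₃ , l₄) = l₂ , l₁ , l₄ , l₃
permute R180 (l₁ , l₂ , l₃ , l₄) = l₃ , l₄ , l₁ , l₂

permute-fromQuadrants : ∀ g f →
  permute g (fromQuadrants f) ≡ fromQuadrants (λ t u → f (flipsRows g xor t) (flipsCols g xor u))
permute-fromQuadrants R0   f = refl
permute-fromQuadrants H    f = refl
permute-fromQuadrants V    f = refl
permute-fromQuadrants R180 f = refl

infixl 7 _·_
_·_ : G → G → G
R0   · g    = g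
g    · R0   = g
H    · H    = R0
V    · V    = R0
R180 · R180 = R0
H    · V    = R180
V    · H    = R180
H    · R180 = V
R180 · H    = V
V    · R180 = H
R180 · V    = H

permute-· : ∀ h g p → permute h (permute g p) ≡ permute (h · g) p
permute-· R0   g    p = refl
permute-· H    R0   p = refl
permute-· H    H    p = refl
permute-· H    V    p = refl
permute-· H    R180 p = refl
permute-· V    R0   p = refl
permute-· V    H    p = refl
permute-· V    V    p = refl
permute-· V    R180 p = refl
permute-· R180 R0   p = refl
permute-· R180 H    p = refl
permute-· R180 V    p = refl
permute-· R180 R180 p = refl

allG : List G
allG = R0 ∷ H ∷ V ∷ R180 ∷ []

∈-allG : ∀ g → g ∈ allG
∈-allG R0   = here refl
∈-allG H    = there (here refl)
∈-allG V    = there (there (here refl))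
∈-allG R180 = there (there (there (here refl)))

module _ {B : Set} (_≤B_ : Rel B 0ℓ) {x y : ℕ} {xs ys : B} where

  lex-head : ×-Lex _≡_ _≤_ _≤B_ (x , xs) (y , ys) → x ≤ y
  lex-head (inj₁ (x≤y , _)) = x≤y
  lex-head (inj₂ (refl , _)) = ≤-refl

  lex-tail : x ≡ y → ×-Lex _≡_ _≤_ _≤B_ (x , xs) (y , ys) → xs ≤B ys
  lex-tail x≡y (inj₁ (_ , x≢y)) = contradiction x≡y x≢y
  lex-tail _   (inj₂ (_ , xs≤ys)) = xs≤ys

Lex₂ : Rel (ℕ × ℕ) 0ℓ
Lex₂ = ×-Lex _≡_ _≤_ _≤_

Lex₃ : Rel (ℕ × ℕ × ℕ) 0ℓ
Lex₃ = ×-Lex _≡_ _≤_ Lex₂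

lexOrder : DecTotalOrder _ _ _
lexOrder = ×-decTotalOrder ≤-decTotalOrder
             (×-decTotalOrder ≤-decTotalOrder (×-decTotalOrder ≤-decTotalOrder ≤-decTotalOrder))

open DecTotalOrder lexOrder using (totalOrder)
open TotalOrder totalOrder using () renaming (_≤_ to _≤ₗₑₓ_)
open Data.List.Extrema totalOrder using (argmax; f[xs]≤f[argmax])

maximal⇒Good : ∀ p → (∀ g → permute g p ≤ₗₑₓ p) → Good p
maximal⇒Good (a , b , c , d) maximal =
  (lex-head Lex₃ (maximal V) , lex-head Lex₃ (maximal R180) , lex-head Lex₃ (maximal H)) ,
  (λ a≡b → lex-head _≤_ (lex-tail Lex₂ a≡b (lex-tail Lex₃ (sym a≡b) (maximal V)))) ,
  (λ a≡c → lex-head Lex₂ (lex-tail Lex₃ (sym a≡c) (maximal R180))) ,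
  (λ a≡d → lex-head Lex₂ (lex-tail Lex₃ (sym a≡d) (maximal H)))

-- Opaque because unfolding argmax on symbolic partitions exhausts the type checker's memory.
opaque
  argmaxG : (G → Partition) → G
  argmaxG f = argmax f R0 allG

  ≤-argmaxG : ∀ (f : G → Partition) g → f g ≤ₗₑₓ f (argmaxG f)
  ≤-argmaxG f g = lookup (f[xs]≤f[argmax] {f = f} R0 allG) (∈-allG g)

orbit : Partition → G → Partition
orbit p g = permute g p

orbitMax : Partition → G
orbitMax p = argmaxG (orbit p)

Good-orbitMax : ∀ p → Good (permute (orbitMax p) p)
Good-orbitMax p = maximal⇒Good (permute g p) λ h →
  subst (_≤ₗₑₓ permute g p) (sym (permute-· h g p)) (≤-argmaxG (orbit p) (h · g))
  where
  g : G
  g = orbitMax p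

Good-permute-unique : ∀ g p → Good p → Good (permute g p) → permute g p ≡ p
Good-permute-unique R0 _ _ _ = refl
Good-permute-unique V (a , b , c , d) ((b≤a , _) , ii , _) ((a≤b , _) , ii′ , _)
  with refl ← ≤-antisym a≤b b≤a
  with refl ← ≤-antisym (ii′ refl) (ii refl) = refl
Good-permute-unique R180 (a , b , c , d) ((_ , c≤a , _) , _ , iii , _) ((_ , a≤c , _) , _ , iii′ , _)
  with refl ← ≤-antisym a≤c c≤a
  with refl ← ≤-antisym (iii′ refl) (iii refl) = refl
Good-permute-unique H (a , b , c , d) ((_ , _ , d≤a) , _ , _ , iv) ((_ , _ , a≤d) , _ , _ , iv′)
  with refl ← ≤-antisym a≤d d≤a
  with refl ← ≤-antisym (iv′ refl) (iv refl) = refl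

good? : ∀ p → Dec (Good p)
good? (a , b , c , d) =
  ((b ≤? a) ×-dec (c ≤? a) ×-dec (d ≤? a)) ×-dec
  ((a ≟ b) →-dec (d ≤? c)) ×-dec
  ((a ≟ c) →-dec (d ≤? b)) ×-dec
  ((a ≟ d) →-dec (c ≤? b))

partitionsBoundedBy : ℕ → List Partition
partitionsBoundedBy r = cartesianProduct ns (cartesianProduct ns (cartesianProduct ns ns))
  where
  ns : List ℕ
  ns = upTo (suc r)

∈-partitionsBoundedBy : ∀ {r a b c d} → a ≤ r → b ≤ r → c ≤ r → d ≤ r →
                        (a , b , c , d) ∈ partitionsBoundedBy r
∈-partitionsBoundedBy a≤r b≤r c≤r d≤r =
  ∈-cartesianProduct⁺ (∈-upTo⁺ (s≤s a≤r))
    (∈-cartesianProduct⁺ (∈-upTo⁺ (s≤s b≤r))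
      (∈-cartesianProduct⁺ (∈-upTo⁺ (s≤s c≤r)) (∈-upTo⁺ (s≤s d≤r))))

module _ {k l : ℕ} where

  reflectBoard : Bool → Bool → Board k l → Board k l
  reflectBoard s t b = board λ i j → cell b (reflect s i) (reflect t j)

  act-cell : ∀ g (b : Board k l) i j →
             cell (act g b) i j ≡ cell (reflectBoard (flipsRows g) (flipsCols g) b) i j
  act-cell R0   b i j = refl
  act-cell H    b i j = refl
  act-cell V    b i j = refl
  act-cell R180 b i j = refl

  countWhere-cong : ∀ {p q : Fin (2 * k) → Fin (2 * l) → Bool} {b b′ : Board k l} →
                    (∀ i j → p i j ≡ q i j) → (∀ i j → cell b i j ≡ cell b′ i j) →
                    countWhere p b ≡ countWhere q b′
  countWhere-cong p≗q b≗b′ = ΣFin-cong _ λ i → ΣFin-cong _ λ j →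
    cong₂ (λ x y → if x ∧ y then 1 else 0) (p≗q i j) (b≗b′ i j)

  countWhere-≤-blocked : ∀ p (b : Board k l) → countWhere p b ≤ blocked b
  countWhere-≤-blocked p b =
    ΣFin-mono _ λ i → ΣFin-mono _ λ j → indicator-mono (p i j) (cell b i j)
    where
    indicator-mono : ∀ x y → (if x ∧ y then 1 else 0) ≤ (if y then 1 else 0)
    indicator-mono false false = z≤n
    indicator-mono false true  = z≤n
    indicator-mono true  y     = ≤-refl

  countWhere-reflect : ∀ s t p (b : Board k l) →
    countWhere (λ i j → p (reflect s i) (reflect t j)) (reflectBoard s t b) ≡ countWhere p b
  countWhere-reflect s t p b =
    trans (ΣFin-cong (2 * k) λ i → ΣFin-reflect (2 * l) t (indicator (reflect s i)))
          (ΣFin-reflect (2 * k) s λ i → ΣFin (2 * l) (indicator i))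
    where
    indicator : Fin (2 * k) → Fin (2 * l) → ℕ
    indicator i j = if p i j ∧ cell b i j then 1 else 0

  countWhere-act : ∀ g p (b : Board k l) →
    countWhere p (act g b) ≡
    countWhere (λ i j → p (reflect (flipsRows g) i) (reflect (flipsCols g) j)) b
  countWhere-act g p b = trans
    (countWhere-cong (λ i j → sym (cong₂ p (reflect-involutive (flipsRows g) i)
                                           (reflect-involutive (flipsCols g) j)))
                     (act-cell g b))
    (countWhere-reflect (flipsRows g) (flipsCols g) _ b)

  blocked-act : ∀ g (b : Board k l) → blocked (act g b) ≡ blocked b
  blocked-act g = countWhere-act g (λ _ _ → true)

  quadrant : Bool → Bool → Fin (2 * k) → Fin (2 * l) → Bool
  quadrant t u i j = onSide t (top {k} i) ∧ onSide u (left {l} j)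

  quadrantCount : Board k l → Bool → Bool → ℕ
  quadrantCount b t u = countWhere (quadrant t u) b

  quadrantCount-cong : ∀ {b b′ : Board k l} → (∀ i j → cell b i j ≡ cell b′ i j) →
                       ∀ t u → quadrantCount b t u ≡ quadrantCount b′ t u
  quadrantCount-cong b≗b′ t u = countWhere-cong {p = quadrant t u} (λ _ _ → refl) b≗b′

  quadrantCount-act : ∀ g (b : Board k l) t u →
    quadrantCount (act g b) t u ≡ quadrantCount b (flipsRows g xor t) (flipsCols g xor u)
  quadrantCount-act g b t u =
    trans (countWhere-act g (quadrant t u) b) (countWhere-cong inQuadrant (λ _ _ → refl))
    where
    inQuadrant : ∀ i j → quadrant t u (reflect (flipsRows g) i) (reflect (flipsCols g) j) ≡
                         quadrant (flipsRows g xor t) (flipsCols g xor u) i j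
    inQuadrant i j = cong₂ _∧_
      (trans (cong (onSide t) (top-reflect {k} (flipsRows g) i)) (onSide-xor (flipsRows g) t _))
      (trans (cong (onSide u) (top-reflect {l} (flipsCols g) j)) (onSide-xor (flipsCols g) u _))

  partition-act : ∀ g (b : Board k l) → partition (act g b) ≡ permute g (partition b)
  partition-act g b = trans (fromQuadrants-cong (quadrantCount-act g b))
                            (sym (permute-fromQuadrants g (quadrantCount b)))

  partition-cong : ∀ {b b′ : Board k l} → (∀ i j → cell b i j ≡ cell b′ i j) →
                   partition b ≡ partition b′
  partition-cong b≗b′ = fromQuadrants-cong (quadrantCount-cong b≗b′)

  partition∈partitionsBoundedBy : ∀ {r} (b : Board k l) → InB r b →
                                  partition b ∈ partitionsBoundedBy r
  partition∈partitionsBoundedBy {r} b b∈B =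
    ∈-partitionsBoundedBy (bound (quadrant true true)) (bound (quadrant true false))
                          (bound (quadrant false false)) (bound (quadrant false true))
    where
    bound : ∀ p → countWhere p b ≤ r
    bound p = subst (countWhere p b ≤_) b∈B (countWhere-≤-blocked p b)

  InBbar-byPartition : ∀ r →
    ∃[ Ps ] (∀ (b : Board k l) → InB r b → (InBbar r b ⇔ partition b ∈ Ps))
  InBbar-byPartition r = filter good? (partitionsBoundedBy r) , λ b b∈B → mk⇔
    (λ (_ , good) → ∈-filter⁺ good? (partition∈partitionsBoundedBy b b∈B) good)
    (λ p∈Ps → b∈B , proj₂ (∈-filter⁻ good? {xs = partitionsBoundedBy r} p∈Ps))

  InB⇒equivalent-InBbar : ∀ {r} (b : Board k l) → InB r b →
                          ∃[ g ] ∃[ b′ ] (b ≈[ g ] b′ × InBbar r b′)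
  InB⇒equivalent-InBbar b b∈B =
    g , act g b , (λ _ _ → refl) ,
    trans (blocked-act g b) b∈B , subst Good (sym (partition-act g b)) (Good-orbitMax (partition b))
    where
    g : G
    g = orbitMax (partition b)

  equivalent-InBbar⇒partition≡ : ∀ {r} (b b′ : Board k l) → InBbar r b → InBbar r b′ →
                                 ∃[ g ] (b ≈[ g ] b′) → partition b ≡ partition b′
  equivalent-InBbar⇒partition≡ b b′ (_ , good) (_ , good′) (g , b≈b′) = begin
    partition b             ≡⟨ Good-permute-unique g (partition b) good good-permuted ⟨
    permute g (partition b) ≡⟨ partition-act g b ⟨
    partition (act g b)     ≡⟨ partition-cong b≈b′ ⟩
    partition b′            ∎
    where
    open ≡-Reasoning
    good-permuted : Good (permute g (partition b))
    good-permuted = subst Good (trans (sym (partition-cong b≈b′)) (partition-act g b)) good′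

theorem4p5 : (k l r : ℕ) → 1 ≤ k → 1 ≤ l → k ≢ l → 1 ≤ r → r ≤ 4 * k * l →
    (∃[ Ps ] (∀ (b : Board k l) → InB r b → (InBbar r b ⇔ partition b ∈ Ps)))
    × (∀ (b : Board k l) → InB r b →
         ∃[ g ] ∃[ b' ] (b ≈[ g ] b' × InBbar r b'))
    × (∀ (b b' : Board k l) → InBbar r b → InBbar r b' →
         ∃[ g ] (b ≈[ g ] b') → partition b ≡ partition b')
theorem4p5 k l r _ _ _ _ _ =
  InBbar-byPartition r , InB⇒equivalent-InBbar , equivalent-InBbar⇒partition≡
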